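{- Let $d\ge 3$ and let $h,g$ be distinct $d$-uniform hypergraphs on the same vertex set with $\mathrm{Proj}_W(h)=\mathrm{Proj}_W(g)$. Then $d-1-\frac{1}{m(h)}\ge\frac d2-1\ge\frac{d-1}{d+1}$.
   Context: $\mathrm{Proj}_W(H)$ is the edge-weighted graph on the vertex set of $H$ where the weight of $\{i,j\}$ is the number of hyperedges of $H$ containing $\{i,j\}$. $m(H)=\max_{K\subseteq H} e(K)/v(K)$ over subhypergraphs $K$ of $H$, where $e,v$ count hyperedges and vertices. -}

module Defs where

open import Data.Bool using (Bool; true; false; _∧_; not; if_then_else_)
open import Data.Nat using (ℕ; zero; suc)
open import Data.Fin using (Fin)
open import Data.Fin.Subset using (Subset)
open import Data.Vec using (Vec; []; _∷_; lookup)
open import Data.List using (List; []; _∷_; map; concatMap; filter; length; foldr; _++_)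
open import Data.Integer using (+_)
open import Data.Rational using (ℚ; 0ℚ; _/_; _⊔_)
open import Relation.Binary.PropositionalEquality using (_≡_)

-- A hypergraph on the vertex set Fin n, given by the indicator of its
-- set of hyperedges (each hyperedge is a subset of the vertices).
Hypergraph : ℕ → Set
Hypergraph n = Subset n → Bool

Uniform : {n : ℕ} → ℕ → Hypergraph n → Set
Uniform d H = ∀ s → H s ≡ true → Data.Fin.Subset.∣ s ∣ ≡ d

allSubsets : (n : ℕ) → List (Subset n)
allSubsets zero = [] ∷ []
allSubsets (suc n) = map (true ∷_) (allSubsets n) ++ map (false ∷_) (allSubsets n)

edges : {n : ℕ} → Hypergraph n → List (Subset n)
edges {n} H = filter (λ s → Data.Bool._≟_ (H s) true) (allSubsets n)

count : {A : Set} → (A → Bool) → List A → ℕ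
count p [] = 0
count p (x ∷ xs) = if p x then suc (count p xs) else count p xs

projW : {n : ℕ} → Hypergraph n → Fin n → Fin n → ℕ
projW H i j = count (λ s → lookup s i ∧ lookup s j) (edges H)

SameProjW : {n : ℕ} → Hypergraph n → Hypergraph n → Set
SameProjW H G = ∀ i j → ¬≡ i j → projW H i j ≡ projW G i j
  where
  open import Relation.Nullary using (¬_)
  ¬≡ : ∀ {n} → Fin n → Fin n → Set
  ¬≡ i j = ¬ (i ≡ j)

sublists : {A : Set} → List A → List (List A)
sublists [] = [] ∷ []
sublists (x ∷ xs) = map (x ∷_) (sublists xs) ++ sublists xs

subsetB : {n : ℕ} → Subset n → Subset n → Bool
subsetB [] [] = true
subsetB (true ∷ s) (false ∷ t) = false
subsetB (_ ∷ s) (_ ∷ t) = subsetB s t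

allB : {A : Set} → (A → Bool) → List A → Bool
allB p = foldr (λ x b → p x ∧ b) true

-- Ratio e / v as a rational (only used with v ≠ 0).
ratio : ℕ → ℕ → ℚ
ratio e zero = 0ℚ
ratio e (suc v) = (+ e) / suc v

-- A subhypergraph K = (V', E') of H: V' a nonempty vertex set, E' a
-- sub-collection of the hyperedges of H, each contained in V'.
-- Its density e(K)/v(K) if it is a valid subhypergraph, else 0 (harmless since
-- all densities are ≥ 0).
density : {n : ℕ} → Subset n → List (Subset n) → ℚ
density V E with allB (λ e → subsetB e V) E
... | true = ratio (length E) (Data.Fin.Subset.∣ V ∣)
... | false = 0ℚ

m : {n : ℕ} → Hypergraph n → ℚ
m {n} H = foldr _⊔_ 0ℚ
  (concatMap (λ V → map (density V) (sublists (edges H))) (allSubsets n))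

-- Let A = h ∖ g and B = g ∖ h. Cancelling the common edges in Proj_W(h) = Proj_W(g) shows that
-- the edge-disjoint d-uniform hypergraphs A and B also have equal projections, and A is
-- nonempty since h ≠ g. If v lies in an edge e of A, pick u ≠ v in e: the pair {v,u} lies in
-- an edge f of B, which has a vertex w ∉ e because f ≠ e and |f| = |e|, and then the pair
-- {v,w} of f lies in an edge of A other than e. So no vertex has A-degree 1, and double
-- counting gives 2|V| ≤ d|E(A)| for the set V of vertices covered by A. The subhypergraph
-- (V, E(A)) of h therefore has density at least 2/d, so 1/m(h) ≤ d/2, which is the first
-- inequality; the second is (d-1)·2 ≤ (d-2)(d+1) for d ≥ 3.

module Submission where

open import Defs
open import Data.Nat using (ℕ; _≤_; _∸_; suc)
open import Data.Integer using (+_)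
open import Data.Rational using (ℚ; _/_; _-_; 1ℚ; 1/_; NonZero)
open import Data.Rational using () renaming (_≤_ to _≤ℚ_)
open import Data.Product using (Σ; _×_)
open import Relation.Nullary using (¬_)
open import Relation.Binary.PropositionalEquality using (_≡_)

open import Data.Bool using (Bool; true; false; _∧_; not; _≟_)
open import Data.Bool.Properties using (∧-comm; ∧-conicalˡ; ∧-conicalʳ)
open import Data.Empty using (⊥)
open import Data.Fin using (Fin; zero; suc)
import Data.Fin.Properties as Fin
open import Data.Fin.Subset using (Subset; ∣_∣)
open import Data.Fin.Subset.Properties using (∣p∣≤∣x∷p∣; anySubset?)
open import Data.Integer as ℤ using (+[1+_]; -[1+_]; +≤+)
import Data.Integer.Properties as ℤ
import Data.Integer.Tactic.RingSolver as ℤ-Solver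
open import Data.List using (List; []; _∷_; map; filter; foldr; length)
open import Data.List.Membership.Propositional using (_∈_; lose)
open import Data.List.Membership.Propositional.Properties
  using (∈-map⁺; ∈-++⁺ˡ; ∈-++⁺ʳ; ∈-filter⁺; ∈-filter⁻; ∈-concatMap⁺)
open import Data.List.Relation.Unary.All as All using (All; []; _∷_)
open import Data.List.Relation.Unary.Any using (here; there)
open import Data.Nat as ℕ using (zero; _*_; _+_; z≤n; s≤s; _≤?_)
import Data.Nat.Properties as ℕ
import Data.Nat.Tactic.RingSolver as ℕ-Solver
open import Algebra.Properties.CommutativeSemigroup ℕ.*-commutativeSemigroup using (xy∙z≈xz∙y)
open import Algebra.Properties.Semiring.Sum ℕ.+-*-semiring
  using (sum-syntax; ∑-distrib-+; *-distribˡ-sum; sum-cong-≗; sum-replicate-zero)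
open import Data.Product using (_,_; proj₂; ∃-syntax)
open import Data.Rational using (mkℚ; toℚᵘ; 0ℚ; _⊔_) renaming (_+_ to _+ℚ_)
import Data.Rational.Properties as ℚ
open import Data.Rational.Solver using (module +-*-Solver)
open import Data.Rational.Unnormalised as ℚᵘ using (mkℚᵘ; *≤*; *≡*)
  renaming (_+_ to _+ᵘ_; _-_ to _-ᵘ_)
import Data.Rational.Unnormalised.Properties as ℚᵘ
open import Data.Vec using ([]; _∷_; lookup; tabulate)
open import Data.Vec.Properties using (lookup∘tabulate)
open import Function using (_∘_)
open import Relation.Binary.PropositionalEquality
  using (refl; sym; trans; cong; cong₂; subst; subst₂; _≢_; module ≡-Reasoning)
open import Relation.Nullary using (yes; no; does; contradiction; ¬?)
open import Relation.Nullary.Decidable using (dec-true; decidable-stable)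
open import Relation.Unary using (Decidable)

indicator : Bool → ℕ
indicator true = 1
indicator false = 0

true-false⇒≢ : ∀ {A : Set} (p : A → Bool) {x y} → p x ≡ true → p y ≡ false → x ≢ y
true-false⇒≢ p px py refl = contradiction (trans (sym px) py) λ ()

∧-exchange : ∀ a b c → a ∧ (b ∧ c) ≡ (b ∧ a) ∧ c
∧-exchange true  true  c = refl
∧-exchange true  false c = refl
∧-exchange false true  c = refl
∧-exchange false false c = refl

module _ {A : Set} where

  count-∷ : ∀ (p : A → Bool) x xs → count p (x ∷ xs) ≡ indicator (p x) + count p xs
  count-∷ p x xs with p x
  ... | true  = refl
  ... | false = refl

  count-∷⁺ : ∀ (p : A → Bool) {x} xs → p x ≡ true → count p (x ∷ xs) ≡ suc (count p xs)
  count-∷⁺ p {x} xs px = trans (count-∷ p x xs) (cong (λ b → indicator b + count p xs) px)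

  count-≤-∷ : ∀ (p : A → Bool) x xs → count p xs ≤ count p (x ∷ xs)
  count-≤-∷ p x xs with p x
  ... | true  = ℕ.n≤1+n _
  ... | false = ℕ.≤-refl

  count-cong : ∀ {p q : A → Bool} → (∀ x → p x ≡ q x) → ∀ xs → count p xs ≡ count q xs
  count-cong p≗q [] = refl
  count-cong {q = q} p≗q (x ∷ xs) rewrite p≗q x with q x
  ... | true  = cong suc (count-cong p≗q xs)
  ... | false = count-cong p≗q xs

  count-split : ∀ (q p : A → Bool) xs →
                count p xs ≡ count (λ x → q x ∧ p x) xs + count (λ x → not (q x) ∧ p x) xs
  count-split q p [] = refl
  count-split q p (x ∷ xs) with q x | p x
  ... | true  | true  = cong suc (count-split q p xs)
  ... | true  | false = count-split q p xs
  ... | false | true  = trans (cong suc (count-split q p xs)) (sym (ℕ.+-suc _ _))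
  ... | false | false = count-split q p xs

  count-filter : ∀ (q p : A → Bool) xs →
                 count p (filter (λ x → q x ≟ true) xs) ≡ count (λ x → q x ∧ p x) xs
  count-filter q p [] = refl
  count-filter q p (x ∷ xs) with q x
  ... | false = count-filter q p xs
  ... | true with p x
  ...   | true  = cong suc (count-filter q p xs)
  ...   | false = count-filter q p xs

  ∈⇒1≤count : ∀ (p : A → Bool) {x xs} → x ∈ xs → p x ≡ true → 1 ≤ count p xs
  ∈⇒1≤count p {xs = _ ∷ xs} (here refl) px =
    subst (1 ≤_) (sym (count-∷⁺ p xs px)) (s≤s z≤n)
  ∈⇒1≤count p {xs = y ∷ xs} (there x∈xs) px =
    ℕ.≤-trans (∈⇒1≤count p x∈xs px) (count-≤-∷ p y xs)

  1≤count⇒∃ : ∀ (p : A → Bool) xs → 1 ≤ count p xs → ∃[ x ] x ∈ xs × p x ≡ true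
  1≤count⇒∃ p (x ∷ xs) 1≤count with p x in px
  ... | true  = x , here refl , px
  ... | false = let y , y∈xs , py = 1≤count⇒∃ p xs 1≤count in y , there y∈xs , py

  2≤count : ∀ (p : A → Bool) {x y xs} → x ∈ xs → y ∈ xs → x ≢ y →
            p x ≡ true → p y ≡ true → 2 ≤ count p xs
  2≤count p (here refl) (here refl) x≢y _ _ = contradiction refl x≢y
  2≤count p {xs = _ ∷ xs} (here refl) (there y∈xs) _ px py =
    subst (2 ≤_) (sym (count-∷⁺ p xs px)) (s≤s (∈⇒1≤count p y∈xs py))
  2≤count p {xs = _ ∷ xs} (there x∈xs) (here refl) _ px py =
    subst (2 ≤_) (sym (count-∷⁺ p xs py)) (s≤s (∈⇒1≤count p x∈xs px))
  2≤count p {xs = z ∷ xs} (there x∈xs) (there y∈xs) x≢y px py =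
    ℕ.≤-trans (2≤count p x∈xs y∈xs x≢y px py) (count-≤-∷ p z xs)

filter-∈-sublists : ∀ {A : Set} {P Q : A → Set} (P? : Decidable P) (Q? : Decidable Q) →
                    (∀ {x} → P x → Q x) → ∀ xs → filter P? xs ∈ sublists (filter Q? xs)
filter-∈-sublists P? Q? P⇒Q [] = here refl
filter-∈-sublists P? Q? P⇒Q (x ∷ xs) with P? x | Q? x
... | yes _  | yes _  = ∈-++⁺ˡ (∈-map⁺ (x ∷_) (filter-∈-sublists P? Q? P⇒Q xs))
... | no _   | yes _  =
  ∈-++⁺ʳ (map (x ∷_) (sublists (filter Q? xs))) (filter-∈-sublists P? Q? P⇒Q xs)
... | yes Px | no ¬Qx = contradiction (P⇒Q Px) ¬Qx
... | no _   | no _   = filter-∈-sublists P? Q? P⇒Q xs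

foldr-⊔-upper : ∀ {x} xs → x ∈ xs → x ≤ℚ foldr _⊔_ 0ℚ xs
foldr-⊔-upper (x ∷ xs) (here refl)  = ℚ.p≤p⊔q x _
foldr-⊔-upper (y ∷ xs) (there x∈xs) = ℚ.p≤q⇒p≤r⊔q y (foldr-⊔-upper xs x∈xs)

allB-intro : ∀ {A : Set} (p : A → Bool) xs → (∀ {x} → x ∈ xs → p x ≡ true) → allB p xs ≡ true
allB-intro p [] _ = refl
allB-intro p (x ∷ xs) all-p rewrite all-p (here refl) = allB-intro p xs (all-p ∘ there)

∈⇒1≤∣p∣ : ∀ {n} (p : Subset n) i → lookup p i ≡ true → 1 ≤ ∣ p ∣
∈⇒1≤∣p∣ (true ∷ p) zero    _  = s≤s z≤n
∈⇒1≤∣p∣ (x ∷ p)    (suc i) pi = ℕ.≤-trans (∈⇒1≤∣p∣ p i pi) (∣p∣≤∣x∷p∣ x p)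

1≤∣p∣⇒∈ : ∀ {n} (p : Subset n) → 1 ≤ ∣ p ∣ → ∃[ i ] lookup p i ≡ true
1≤∣p∣⇒∈ (true ∷ p)  _      = zero , refl
1≤∣p∣⇒∈ (false ∷ p) 1≤∣p∣ = let i , pi = 1≤∣p∣⇒∈ p 1≤∣p∣ in suc i , pi

2≤∣p∣⇒∈-≢ : ∀ {n} (p : Subset n) v → 2 ≤ ∣ p ∣ → ∃[ i ] i ≢ v × lookup p i ≡ true
2≤∣p∣⇒∈-≢ (true ∷ p) zero (s≤s 1≤∣p∣) =
  let i , pi = 1≤∣p∣⇒∈ p 1≤∣p∣ in suc i , (λ ()) , pi
2≤∣p∣⇒∈-≢ (false ∷ p) zero 2≤∣p∣ =
  let i , pi = 1≤∣p∣⇒∈ p (ℕ.≤-trans (ℕ.n≤1+n 1) 2≤∣p∣) in suc i , (λ ()) , pi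
2≤∣p∣⇒∈-≢ (true ∷ p) (suc v) _ = zero , (λ ()) , refl
2≤∣p∣⇒∈-≢ (false ∷ p) (suc v) 2≤∣p∣ =
  let i , i≢v , pi = 2≤∣p∣⇒∈-≢ p v 2≤∣p∣ in suc i , i≢v ∘ Fin.suc-injective , pi

∣q∣≤∣p∣⇒p≢q⇒∈∖ : ∀ {n} (p q : Subset n) → ∣ q ∣ ≤ ∣ p ∣ → p ≢ q →
                 ∃[ i ] lookup p i ≡ true × lookup q i ≡ false
∣q∣≤∣p∣⇒p≢q⇒∈∖ [] [] _ p≢q = contradiction refl p≢q
∣q∣≤∣p∣⇒p≢q⇒∈∖ (true ∷ p) (false ∷ q) _ _ = zero , refl , refl
∣q∣≤∣p∣⇒p≢q⇒∈∖ (true ∷ p) (true ∷ q) (s≤s ∣q∣≤∣p∣) p≢q =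
  let i , pi , qi = ∣q∣≤∣p∣⇒p≢q⇒∈∖ p q ∣q∣≤∣p∣ (p≢q ∘ cong (true ∷_)) in suc i , pi , qi
∣q∣≤∣p∣⇒p≢q⇒∈∖ (false ∷ p) (false ∷ q) ∣q∣≤∣p∣ p≢q =
  let i , pi , qi = ∣q∣≤∣p∣⇒p≢q⇒∈∖ p q ∣q∣≤∣p∣ (p≢q ∘ cong (false ∷_)) in suc i , pi , qi
∣q∣≤∣p∣⇒p≢q⇒∈∖ (false ∷ p) (true ∷ q) ∣q∣<∣p∣ _ =
  let i , pi , qi = ∣q∣≤∣p∣⇒p≢q⇒∈∖ p q (ℕ.<⇒≤ ∣q∣<∣p∣) (λ { refl → ℕ.<-irrefl refl ∣q∣<∣p∣ })
  in suc i , pi , qi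

∣p∣≡∑ : ∀ {n} (p : Subset n) → ∣ p ∣ ≡ ∑[ i < n ] indicator (lookup p i)
∣p∣≡∑ []          = refl
∣p∣≡∑ (true ∷ p)  = cong suc (∣p∣≡∑ p)
∣p∣≡∑ (false ∷ p) = ∣p∣≡∑ p

subsetB-intro : ∀ {n} (p q : Subset n) → (∀ i → lookup p i ≡ true → lookup q i ≡ true) →
                subsetB p q ≡ true
subsetB-intro []          []          _   = refl
subsetB-intro (true ∷ p)  (false ∷ q) p⊆q = p⊆q zero refl
subsetB-intro (true ∷ p)  (true ∷ q)  p⊆q = subsetB-intro p q (p⊆q ∘ suc)
subsetB-intro (false ∷ p) (true ∷ q)  p⊆q = subsetB-intro p q (p⊆q ∘ suc)
subsetB-intro (false ∷ p) (false ∷ q) p⊆q = subsetB-intro p q (p⊆q ∘ suc)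

sum-mono-≤ : ∀ {n} {f g : Fin n → ℕ} → (∀ i → f i ≤ g i) → ∑[ i < n ] f i ≤ ∑[ i < n ] g i
sum-mono-≤ {zero}  _   = z≤n
sum-mono-≤ {suc n} f≤g = ℕ.+-mono-≤ (f≤g zero) (sum-mono-≤ (f≤g ∘ suc))

degree : ∀ {n} → List (Subset n) → Fin n → ℕ
degree E v = count (λ e → lookup e v) E

support : ∀ {n} → List (Subset n) → Subset n
support E = tabulate (λ v → does (1 ≤? degree E v))

∈⇒∈-support : ∀ {n} {E : List (Subset n)} {e} v → e ∈ E → lookup e v ≡ true →
               lookup (support E) v ≡ true
∈⇒∈-support {E = E} v e∈E ev = trans (lookup∘tabulate _ v)
  (dec-true (1 ≤? degree E v) (∈⇒1≤count (λ e → lookup e v) e∈E ev))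

degree-sum : ∀ {n d} (E : List (Subset n)) → All (λ e → ∣ e ∣ ≡ d) E →
             ∑[ v < n ] degree E v ≡ length E * d
degree-sum {n} [] [] = sum-replicate-zero n
degree-sum {n} {d} (e ∷ E) (∣e∣≡d ∷ uniform) = begin
  ∑[ v < n ] degree (e ∷ E) v
    ≡⟨ sum-cong-≗ (λ v → count-∷ (λ e → lookup e v) e E) ⟩
  ∑[ v < n ] (indicator (lookup e v) + degree E v)
    ≡⟨ ∑-distrib-+ (indicator ∘ lookup e) (degree E) ⟩
  ∑[ v < n ] indicator (lookup e v) + ∑[ v < n ] degree E v
    ≡⟨ cong₂ _+_ (trans (sym (∣p∣≡∑ e)) ∣e∣≡d) (degree-sum E uniform) ⟩
  d + length E * d
    ∎
  where open ≡-Reasoning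

twice-indicator≤ : ∀ x → (1 ≤ x → 2 ≤ x) → 2 * indicator (does (1 ≤? x)) ≤ x
twice-indicator≤ zero    _         = z≤n
twice-indicator≤ (suc x) 1≤x⇒2≤x = 1≤x⇒2≤x (s≤s z≤n)

2*∣support∣≤∑degree : ∀ {n} (E : List (Subset n)) → (∀ v → 1 ≤ degree E v → 2 ≤ degree E v) →
                      2 * ∣ support E ∣ ≤ ∑[ v < n ] degree E v
2*∣support∣≤∑degree {n} E no-degree-one = begin
  2 * ∣ V ∣                                ≡⟨ cong (2 *_) (∣p∣≡∑ V) ⟩
  2 * ∑[ v < n ] indicator (lookup V v)    ≡⟨ *-distribˡ-sum 2 (indicator ∘ lookup V) ⟩
  ∑[ v < n ] (2 * indicator (lookup V v))  ≤⟨ sum-mono-≤ twice-indicator≤degree ⟩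
  ∑[ v < n ] degree E v                    ∎
  where
  open ℕ.≤-Reasoning
  V = support E
  twice-indicator≤degree : ∀ v → 2 * indicator (lookup V v) ≤ degree E v
  twice-indicator≤degree v = subst (λ b → 2 * indicator b ≤ degree E v) (sym (lookup∘tabulate _ v))
    (twice-indicator≤ (degree E v) (no-degree-one v))

∈-allSubsets : ∀ {n} (s : Subset n) → s ∈ allSubsets n
∈-allSubsets [] = here refl
∈-allSubsets {suc n} (true ∷ s) = ∈-++⁺ˡ (∈-map⁺ (true ∷_) (∈-allSubsets s))
∈-allSubsets {suc n} (false ∷ s) =
  ∈-++⁺ʳ (map (true ∷_) (allSubsets n)) (∈-map⁺ (false ∷_) (∈-allSubsets s))

module _ {n : ℕ} where

  _∖_ : Hypergraph n → Hypergraph n → Hypergraph n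
  (H ∖ G) s = H s ∧ not (G s)

  _∩_ : Hypergraph n → Hypergraph n → Hypergraph n
  (H ∩ G) s = H s ∧ G s

  ∖-disjoint : ∀ (H G : Hypergraph n) s → (H ∖ G) s ≡ true → (G ∖ H) s ≡ true → ⊥
  ∖-disjoint H G s H∖G G∖H with H s | G s
  ... | true  | true  = contradiction H∖G λ ()
  ... | true  | false = contradiction G∖H λ ()
  ... | false | _     = contradiction H∖G λ ()

  Uniform-∖ : ∀ {d} {H : Hypergraph n} (G : Hypergraph n) → Uniform d H → Uniform d (H ∖ G)
  Uniform-∖ {H = H} G uniform s H∖G = uniform s (∧-conicalˡ (H s) _ H∖G)

  ∈-edges⁺ : ∀ {H : Hypergraph n} {s} → H s ≡ true → s ∈ edges H
  ∈-edges⁺ {H} {s} Hs = ∈-filter⁺ (λ s → H s ≟ true) (∈-allSubsets s) Hs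

  ∈-edges⁻ : ∀ {H : Hypergraph n} {s} → s ∈ edges H → H s ≡ true
  ∈-edges⁻ {H} s∈edges = proj₂ (∈-filter⁻ (λ s → H s ≟ true) {xs = allSubsets n} s∈edges)

  edges-∈-sublists : ∀ {K H : Hypergraph n} → (∀ {s} → K s ≡ true → H s ≡ true) →
                     edges K ∈ sublists (edges H)
  edges-∈-sublists {K} {H} K⊆H =
    filter-∈-sublists (λ s → K s ≟ true) (λ s → H s ≟ true) K⊆H (allSubsets n)

  density-≤-m : ∀ (H : Hypergraph n) V E → E ∈ sublists (edges H) →
                (∀ {e} → e ∈ E → ∀ v → lookup e v ≡ true → lookup V v ≡ true) →
                ratio (length E) ∣ V ∣ ≤ℚ m H
  density-≤-m H V E E∈sublists E⊆V = subst (_≤ℚ m H) density≡ratio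
    (foldr-⊔-upper _ (∈-concatMap⁺ _ (lose (∈-allSubsets V) (∈-map⁺ (density V) E∈sublists))))
    where
    density≡ratio : density V E ≡ ratio (length E) ∣ V ∣
    density≡ratio
      rewrite allB-intro (λ e → subsetB e V) E (λ {e} e∈E → subsetB-intro e V (E⊆V e∈E)) = refl

  projW≡count : ∀ (H : Hypergraph n) i j →
                projW H i j ≡ count (λ s → H s ∧ (lookup s i ∧ lookup s j)) (allSubsets n)
  projW≡count H i j = count-filter H (λ s → lookup s i ∧ lookup s j) (allSubsets n)

  projW-cong : ∀ {H G : Hypergraph n} → (∀ s → H s ≡ G s) → ∀ i j → projW H i j ≡ projW G i j
  projW-cong {H} {G} H≗G i j = begin
    projW H i j                         ≡⟨ projW≡count H i j ⟩
    count (λ s → H s ∧ pair s) S        ≡⟨ count-cong (λ s → cong (_∧ pair s) (H≗G s)) S ⟩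
    count (λ s → G s ∧ pair s) S        ≡⟨ projW≡count G i j ⟨
    projW G i j                         ∎
    where
    open ≡-Reasoning
    S = allSubsets n
    pair : Subset n → Bool
    pair s = lookup s i ∧ lookup s j

  projW-split : ∀ (H G : Hypergraph n) i j → projW H i j ≡ projW (H ∩ G) i j + projW (H ∖ G) i j
  projW-split H G i j = begin
    projW H i j
      ≡⟨ projW≡count H i j ⟩
    count (λ s → H s ∧ pair s) S
      ≡⟨ count-split G _ S ⟩
    count (λ s → G s ∧ (H s ∧ pair s)) S + count (λ s → not (G s) ∧ (H s ∧ pair s)) S
      ≡⟨ cong₂ _+_ (count-cong (λ s → ∧-exchange (G s) (H s) (pair s)) S)
                   (count-cong (λ s → ∧-exchange (not (G s)) (H s) (pair s)) S) ⟩
    count (λ s → (H ∩ G) s ∧ pair s) S + count (λ s → (H ∖ G) s ∧ pair s) S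
      ≡⟨ cong₂ _+_ (projW≡count (H ∩ G) i j) (projW≡count (H ∖ G) i j) ⟨
    projW (H ∩ G) i j + projW (H ∖ G) i j
      ∎
    where
    open ≡-Reasoning
    S = allSubsets n
    pair : Subset n → Bool
    pair s = lookup s i ∧ lookup s j

  SameProjW-sym : ∀ {H G : Hypergraph n} → SameProjW H G → SameProjW G H
  SameProjW-sym same i j i≢j = sym (same i j i≢j)

  SameProjW-∖ : ∀ {H G : Hypergraph n} → SameProjW H G → SameProjW (H ∖ G) (G ∖ H)
  SameProjW-∖ {H} {G} same i j i≢j = ℕ.+-cancelˡ-≡ (projW (H ∩ G) i j) _ _ (begin
    projW (H ∩ G) i j + projW (H ∖ G) i j   ≡⟨ projW-split H G i j ⟨
    projW H i j                             ≡⟨ same i j i≢j ⟩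
    projW G i j                             ≡⟨ projW-split G H i j ⟩
    projW (G ∩ H) i j + projW (G ∖ H) i j   ≡⟨ cong (_+ projW (G ∖ H) i j) G∩H≡H∩G ⟩
    projW (H ∩ G) i j + projW (G ∖ H) i j   ∎)
    where
    open ≡-Reasoning
    G∩H≡H∩G = projW-cong (λ s → ∧-comm (G s) (H s)) i j

  SameProjW⇒covered : ∀ {A B : Hypergraph n} → SameProjW A B → ∀ {i j e} → i ≢ j →
                      A e ≡ true → lookup e i ≡ true → lookup e j ≡ true →
                      ∃[ f ] B f ≡ true × lookup f i ≡ true × lookup f j ≡ true
  SameProjW⇒covered {A} {B} same {i} {j} i≢j Ae ei ej =
    let f , f∈edges , fij = 1≤count⇒∃ pair (edges B)
          (subst (1 ≤_) (same i j i≢j) (∈⇒1≤count pair (∈-edges⁺ Ae) (cong₂ _∧_ ei ej)))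
    in f , ∈-edges⁻ f∈edges , ∧-conicalˡ _ _ fij , ∧-conicalʳ _ _ fij
    where
    pair : Subset n → Bool
    pair s = lookup s i ∧ lookup s j

module _ {n d : ℕ} (2≤d : 2 ≤ d) {A B : Hypergraph n}
         (uniform-A : Uniform d A) (uniform-B : Uniform d B) (same : SameProjW A B)
         (disjoint : ∀ s → A s ≡ true → B s ≡ true → ⊥) where

  another-edge : ∀ {e v} → A e ≡ true → lookup e v ≡ true →
                 ∃[ e′ ] A e′ ≡ true × lookup e′ v ≡ true × e′ ≢ e
  another-edge {e} {v} Ae ev =
    let u , u≢v , eu = 2≤∣p∣⇒∈-≢ e v (subst (2 ≤_) (sym (uniform-A e Ae)) 2≤d)
        f , Bf , fv , _ = SameProjW⇒covered same (u≢v ∘ sym) Ae ev eu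
        ∣e∣≤∣f∣ = ℕ.≤-reflexive (trans (uniform-A e Ae) (sym (uniform-B f Bf)))
        w , fw , ew = ∣q∣≤∣p∣⇒p≢q⇒∈∖ f e ∣e∣≤∣f∣
                        (λ f≡e → disjoint e Ae (subst (λ s → B s ≡ true) f≡e Bf))
        e′ , Ae′ , e′v , e′w = SameProjW⇒covered (SameProjW-sym same)
                                 (true-false⇒≢ (lookup e) ev ew) Bf fv fw
    in e′ , Ae′ , e′v , true-false⇒≢ (λ s → lookup s w) e′w ew

  1≤degree⇒2≤degree : ∀ v → 1 ≤ degree (edges A) v → 2 ≤ degree (edges A) v
  1≤degree⇒2≤degree v 1≤degree =
    let e , e∈edges , ev = 1≤count⇒∃ (λ e → lookup e v) (edges A) 1≤degree
        e′ , Ae′ , e′v , e′≢e = another-edge (∈-edges⁻ e∈edges) ev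
    in 2≤count (λ e → lookup e v) e∈edges (∈-edges⁺ Ae′) (e′≢e ∘ sym) ev e′v

∖-nonempty : ∀ {n d} {h g : Hypergraph n} → 2 ≤ d → Uniform d g → SameProjW h g →
             ¬ (∀ s → h s ≡ g s) → ∃[ e ] (h ∖ g) e ≡ true
∖-nonempty {h = h} {g} 2≤d uniform-g same h≢g with anySubset? (λ s → ¬? (h s ≟ g s))
... | no ∄ = contradiction (λ s → decidable-stable (h s ≟ g s) (λ hs≢gs → ∄ (s , hs≢gs))) h≢g
... | yes (s , hs≢gs) with h s in hs | g s in gs
...   | true  | true  = contradiction refl hs≢gs
...   | false | false = contradiction refl hs≢gs
...   | true  | false = s , cong₂ (λ a b → a ∧ not b) hs gs
...   | false | true  =
  let 2≤∣s∣ = subst (2 ≤_) (sym (uniform-g s gs)) 2≤d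
      u , su = 1≤∣p∣⇒∈ s (ℕ.≤-trans (ℕ.n≤1+n 1) 2≤∣s∣)
      v , v≢u , sv = 2≤∣p∣⇒∈-≢ s u 2≤∣s∣
      e , h∖g-e , _ = SameProjW⇒covered (SameProjW-sym (SameProjW-∖ same)) (v≢u ∘ sym)
                        (cong₂ (λ a b → a ∧ not b) gs hs) su sv
  in e , h∖g-e

toℚᵘ-/ : ∀ i k → toℚᵘ (i / suc k) ℚᵘ.≃ mkℚᵘ i k
toℚᵘ-/ i k = ℚ.toℚᵘ-fromℚᵘ (mkℚᵘ i k)

toℚᵘ-homo-- : ∀ p q → toℚᵘ (p - q) ℚᵘ.≃ toℚᵘ p -ᵘ toℚᵘ q
toℚᵘ-homo-- p q =
  ℚᵘ.≃-trans (ℚ.toℚᵘ-homo-+ p (Data.Rational.- q)) (ℚᵘ.+-congʳ (toℚᵘ p) (ℚ.toℚᵘ-homo‿- q))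

/-≤⁺ : ∀ a b c d → a * suc d ≤ c * suc b → + a / suc b ≤ℚ + c / suc d
/-≤⁺ a b c d ad≤cb = ℚ.toℚᵘ-cancel-≤
  (ℚᵘ.≤-respˡ-≃ (ℚᵘ.≃-sym (toℚᵘ-/ (+ a) b)) (ℚᵘ.≤-respʳ-≃ (ℚᵘ.≃-sym (toℚᵘ-/ (+ c) d))
    (*≤* (subst₂ ℤ._≤_ (ℤ.pos-* a (suc d)) (ℤ.pos-* c (suc b)) (+≤+ ad≤cb)))))

/-≤⁻ : ∀ a b c d → + a / suc b ≤ℚ + c / suc d → a * suc d ≤ c * suc b
/-≤⁻ a b c d a/b≤c/d
  with ℚᵘ.≤-respˡ-≃ (toℚᵘ-/ (+ a) b) (ℚᵘ.≤-respʳ-≃ (toℚᵘ-/ (+ c) d) (ℚ.toℚᵘ-mono-≤ a/b≤c/d))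
... | *≤* ad≤cb =
  ℤ.drop‿+≤+ (subst₂ ℤ._≤_ (sym (ℤ.pos-* a (suc d))) (sym (ℤ.pos-* c (suc b))) ad≤cb)

half+half : ∀ i → i / 2 +ℚ i / 2 ≡ i / 1
half+half i = ℚ.toℚᵘ-injective (begin
  toℚᵘ (i / 2 +ℚ i / 2)            ≈⟨ ℚ.toℚᵘ-homo-+ (i / 2) (i / 2) ⟩
  toℚᵘ (i / 2) +ᵘ toℚᵘ (i / 2)     ≈⟨ ℚᵘ.+-cong (toℚᵘ-/ i 1) (toℚᵘ-/ i 1) ⟩
  mkℚᵘ i 1 +ᵘ mkℚᵘ i 1             ≈⟨ *≡* (cross-multiplied i) ⟩
  mkℚᵘ i 0                         ≈⟨ toℚᵘ-/ i 0 ⟨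
  toℚᵘ (i / 1)                     ∎)
  where
  open import Relation.Binary.Reasoning.Setoid ℚᵘ.≃-setoid
  cross-multiplied : ∀ i → (i ℤ.* + 2 ℤ.+ i ℤ.* + 2) ℤ.* + 1 ≡ i ℤ.* + 4
  cross-multiplied = ℤ-Solver.solve-∀

half-sub-one : ∀ i → (+ 2 ℤ.+ i) / 2 - 1ℚ ≡ i / 2
half-sub-one i = ℚ.toℚᵘ-injective (begin
  toℚᵘ ((+ 2 ℤ.+ i) / 2 - 1ℚ)          ≈⟨ toℚᵘ-homo-- ((+ 2 ℤ.+ i) / 2) 1ℚ ⟩
  toℚᵘ ((+ 2 ℤ.+ i) / 2) -ᵘ toℚᵘ 1ℚ    ≈⟨ ℚᵘ.+-congˡ _ (toℚᵘ-/ (+ 2 ℤ.+ i) 1) ⟩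
  mkℚᵘ (+ 2 ℤ.+ i) 1 -ᵘ mkℚᵘ (+ 1) 0    ≈⟨ *≡* (cross-multiplied i) ⟩
  mkℚᵘ i 1                             ≈⟨ toℚᵘ-/ i 1 ⟨
  toℚᵘ (i / 2)                         ∎)
  where
  open import Relation.Binary.Reasoning.Setoid ℚᵘ.≃-setoid
  cross-multiplied : ∀ i → ((+ 2 ℤ.+ i) ℤ.* + 1 ℤ.+ (ℤ.- + 1) ℤ.* + 2) ℤ.* + 2 ≡ i ℤ.* + 2
  cross-multiplied = ℤ-Solver.solve-∀

cross-≤-trans : ∀ a b c d e f .{{_ : ℕ.NonZero d}} →
                a * d ≤ c * b → c * f ≤ e * d → a * f ≤ e * b
cross-≤-trans a b c d e f ad≤cb cf≤ed = ℕ.*-cancelʳ-≤ (a * f) (e * b) d (begin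
  a * f * d      ≡⟨ xy∙z≈xz∙y a f d ⟩
  a * d * f      ≤⟨ ℕ.*-monoˡ-≤ f ad≤cb ⟩
  c * b * f      ≡⟨ xy∙z≈xz∙y c b f ⟩
  c * f * b      ≤⟨ ℕ.*-monoˡ-≤ b cf≤ed ⟩
  e * d * b      ≡⟨ xy∙z≈xz∙y e d b ⟩
  e * b * d      ∎)
  where open ℕ.≤-Reasoning

2/d≤ratio≤q⇒1/q≤d/2 : ∀ {d e c} (q : ℚ) → 1 ≤ c → 2 * c ≤ e * d → ratio e c ≤ℚ q →
                      Σ (NonZero q) λ nz → (1/ q) {{nz}} ≤ℚ + d / 2
2/d≤ratio≤q⇒1/q≤d/2 {e = zero} {suc k} q _ 2c≤0 _ = contradiction 2c≤0 λ ()
2/d≤ratio≤q⇒1/q≤d/2 {e = suc e} {suc k} q@(mkℚ (+ zero) b _) _ _ e/c≤q =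
  contradiction (/-≤⁻ (suc e) k 0 b (subst (+ suc e / suc k ≤ℚ_) (sym (ℚ.↥p/↧p≡p q)) e/c≤q)) λ ()
2/d≤ratio≤q⇒1/q≤d/2 {e = suc e} {suc k} q@(mkℚ -[1+ _ ] _ _) _ _ e/c≤q =
  contradiction (ℚ.≤-<-trans 0≤q (ℚ.negative⁻¹ q)) (ℚ.<-irrefl refl)
  where
  0≤q = ℚ.≤-trans (ℚ.nonNegative⁻¹ _ {{ℚ.normalize-nonNeg (suc e) (suc k)}}) e/c≤q
2/d≤ratio≤q⇒1/q≤d/2 {d} {suc e} {suc k} q@(mkℚ +[1+ a ] b _) _ 2c≤ed e/c≤q =
  _ , subst (_≤ℚ + d / 2) (ℚ.↥p/↧p≡p (1/ q)) (/-≤⁺ (suc b) a d 1 (subst₂ _≤_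
        (ℕ.*-comm 2 (suc b)) (ℕ.*-comm (suc a) d)
        (cross-≤-trans 2 d (suc e) (suc k) (suc a) (suc b) 2c≤ed e*b≤a*k)))
  where
  e*b≤a*k = /-≤⁻ (suc e) k (suc a) b (subst (+ suc e / suc k ≤ℚ_) (sym (ℚ.↥p/↧p≡p q)) e/c≤q)

1/m≤d/2 : ∀ {n d} → 1 ≤ d → (H A : Hypergraph n) → Uniform d A →
          (∀ {s} → A s ≡ true → H s ≡ true) → ∃[ e ] A e ≡ true →
          (∀ v → 1 ≤ degree (edges A) v → 2 ≤ degree (edges A) v) →
          Σ (NonZero (m H)) λ nz → (1/ m H) {{nz}} ≤ℚ + d / 2
1/m≤d/2 {d = d} 1≤d H A uniform A⊆H (e , Ae) no-degree-one =
  2/d≤ratio≤q⇒1/q≤d/2 (m H) 1≤∣V∣ 2∣V∣≤∣E∣d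
    (density-≤-m H V E (edges-∈-sublists A⊆H) (λ e∈E v → ∈⇒∈-support v e∈E))
  where
  E = edges A
  V = support E
  1≤∣V∣ : 1 ≤ ∣ V ∣
  1≤∣V∣ = let v , ev = 1≤∣p∣⇒∈ e (subst (1 ≤_) (sym (uniform e Ae)) 1≤d)
          in ∈⇒1≤∣p∣ V v (∈⇒∈-support v (∈-edges⁺ Ae) ev)
  2∣V∣≤∣E∣d : 2 * ∣ V ∣ ≤ length E * d
  2∣V∣≤∣E∣d = ℕ.≤-trans (2*∣support∣≤∑degree E no-degree-one)
                (ℕ.≤-reflexive (degree-sum E (All.tabulate (uniform _ ∘ ∈-edges⁻))))

d/2-1≤d-1-1/q : ∀ d (q : ℚ) .{{_ : NonZero q}} → 1/ q ≤ℚ + d / 2 →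
                + d / 2 - 1ℚ ≤ℚ (+ d / 1 - 1ℚ) - 1/ q
d/2-1≤d-1-1/q d q 1/q≤d/2 = begin
  + d / 2 - 1ℚ                          ≡⟨ rearrange (+ d / 2) ⟩
  (+ d / 2 +ℚ + d / 2 - 1ℚ) - + d / 2   ≡⟨ cong (λ x → x - 1ℚ - + d / 2) (half+half (+ d)) ⟩
  (+ d / 1 - 1ℚ) - + d / 2              ≤⟨ ℚ.+-monoʳ-≤ (+ d / 1 - 1ℚ) (ℚ.neg-antimono-≤ 1/q≤d/2) ⟩
  (+ d / 1 - 1ℚ) - 1/ q                 ∎
  where
  open ℚ.≤-Reasoning
  open +-*-Solver
  rearrange : ∀ x → x - 1ℚ ≡ (x +ℚ x - 1ℚ) - x
  rearrange = solve 1 (λ x → x :- con 1ℚ := (x :+ x :- con 1ℚ) :- x) refl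

d-1/d+1≤d/2-1 : ∀ {d} → 3 ≤ d → + (d ∸ 1) / suc d ≤ℚ + d / 2 - 1ℚ
d-1/d+1≤d/2-1 {suc (suc (suc t))} (s≤s (s≤s (s≤s _))) =
  subst (+ (2 + t) / (4 + t) ≤ℚ_) (sym (half-sub-one (+ suc t)))
    (/-≤⁺ (2 + t) (3 + t) (1 + t) 1 cross-multiplied)
  where
  cross-multiplied : (2 + t) * 2 ≤ (1 + t) * (4 + t)
  cross-multiplied = begin
    (2 + t) * 2                 ≤⟨ ℕ.m≤m+n _ (t * (3 + t)) ⟩
    (2 + t) * 2 + t * (3 + t)   ≡⟨ expand t ⟩
    (1 + t) * (4 + t)           ∎
    where
    open ℕ.≤-Reasoning
    expand : ∀ t → (2 + t) * 2 + t * (3 + t) ≡ (1 + t) * (4 + t)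
    expand = ℕ-Solver.solve-∀

theorem38 : (d n : ℕ) → 3 ≤ d → (h g : Hypergraph n) → Uniform d h → Uniform d g
    → ¬ (∀ s → h s ≡ g s) → SameProjW h g
    → Σ (NonZero (m h)) λ nz →
        (((+ d / 2) - 1ℚ) ≤ℚ (((+ d / 1) - 1ℚ) - 1/_ (m h) {{nz}}))
        × ((+ (d ∸ 1) / suc d) ≤ℚ ((+ d / 2) - 1ℚ))
theorem38 d n 3≤d h g uniform-h uniform-g h≢g same =
  let nz , 1/mh≤d/2 = 1/m≤d/2 1≤d h (h ∖ g) uniform-A (λ {s} → ∧-conicalˡ (h s) _)
                        (∖-nonempty 2≤d uniform-g same h≢g) no-degree-one
  in nz , d/2-1≤d-1-1/q d (m h) {{nz}} 1/mh≤d/2 , d-1/d+1≤d/2-1 3≤d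
  where
  2≤d = ℕ.≤-trans (ℕ.n≤1+n 2) 3≤d
  1≤d = ℕ.≤-trans (ℕ.n≤1+n 1) 2≤d
  uniform-A = Uniform-∖ g uniform-h
  uniform-B = Uniform-∖ h uniform-g
  no-degree-one = 1≤degree⇒2≤degree 2≤d uniform-A uniform-B (SameProjW-∖ same) (∖-disjoint h g)
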